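{- Let $G$ be a finite simple connected graph with diameter $d$, and let $k\ge 0$ be an integer. Then $\mu_k(G)=|V(G)|$ if and only if $k\ge d-1$.
   Context: For $X\subseteq V(G)$ and an integer $k\ge 0$, two vertices $u,v\in V(G)$ are called $(X,k)$-visible if there exists a shortest $(u,v)$-path in $G$ having at most $k$ internal vertices that lie in $X$. A set $X\subseteq V(G)$ is a mutual $k$-visible set if every pair of distinct vertices of $X$ is $(X,k)$-visible. The mutual $k$-visibility number $\mu_k(G)$ is the maximum cardinality of a mutual $k$-visible set in $G$. -}

module Defs where

open import Data.Nat using (ℕ; zero; suc; _≤_)
open import Data.Bool using (Bool; true; false; T; if_then_else_)
open import Data.Fin using (Fin)
open import Data.Fin.Subset using (Subset; ∣_∣)
open import Data.Vec using (lookup)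
open import Data.List using (List; []; _∷_)
open import Data.List.Relation.Unary.Unique.Propositional using (Unique)
open import Data.Product using (Σ; ∃; ∃-syntax; _×_; _,_)
open import Relation.Binary.PropositionalEquality using (_≡_; _≢_)
open import Relation.Nullary using (¬_)

record Graph : Set where
  field
    n     : ℕ
    adj   : Fin n → Fin n → Bool
    sym   : ∀ u v → adj u v ≡ adj v u
    irrefl : ∀ v → adj v v ≡ false

module _ (G : Graph) where
  open Graph G

  V : Set
  V = Fin n

  data Walk : V → V → Set where
    [_]  : (v : V) → Walk v v
    step : (u : V) {w v : V} → T (adj u w) → Walk w v → Walk u v

  len : ∀ {u v} → Walk u v → ℕ
  len [ _ ]          = 0
  len (step _ _ p)   = suc (len p)

  vertices : ∀ {u v} → Walk u v → List V
  vertices [ v ]        = v ∷ []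
  vertices (step u _ p) = u ∷ vertices p

  initVerts : ∀ {u v} → Walk u v → List V
  initVerts [ _ ]        = []
  initVerts (step u _ p) = u ∷ initVerts p

  internal : ∀ {u v} → Walk u v → List V
  internal [ _ ]        = []
  internal (step _ _ p) = initVerts p

  IsPath : ∀ {u v} → Walk u v → Set
  IsPath p = Unique (vertices p)

  IsShortestPath : ∀ {u v} → Walk u v → Set
  IsShortestPath {u} {v} p = IsPath p × (∀ (q : Walk u v) → len p ≤ len q)

  Connected : Set
  Connected = ∀ u v → Walk u v

  Dist : V → V → ℕ → Set
  Dist u v m = Σ (Walk u v) λ p → IsShortestPath p × len p ≡ m

  HasDiameter : ℕ → Set
  HasDiameter d = (∀ u v m → Dist u v m → m ≤ d) × (∃[ u ] ∃[ v ] Dist u v d)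

  countIn : Subset n → List V → ℕ
  countIn X []       = 0
  countIn X (x ∷ xs) = if lookup X x then suc (countIn X xs) else countIn X xs

  Visible : Subset n → ℕ → V → V → Set
  Visible X k u v = Σ (Walk u v) λ p → IsShortestPath p × countIn X (internal p) ≤ k

  MutualVisible : ℕ → Subset n → Set
  MutualVisible k X = ∀ u v → T (lookup X u) → T (lookup X v) → u ≢ v → Visible X k u v

  IsMutualVisNumber : ℕ → ℕ → Set
  IsMutualVisNumber k m =
    (∃[ X ] (MutualVisible k X × ∣ X ∣ ≡ m)) × (∀ X → MutualVisible k X → ∣ X ∣ ≤ m)

{-# OPTIONS --safe #-}
-- μₖ(G) = |V(G)| says exactly that V(G) itself is mutually k-visible.
-- With X = V(G) every internal vertex counts, so a pair at distance m is
-- (X,k)-visible iff m - 1 ≤ k; the largest distance is the diameter d.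
-- Shortest paths exist in a connected graph because a walk of minimal
-- length cannot repeat a vertex.
module Submission where

open import Defs
open import Data.Nat using (ℕ; zero; suc; _≤_; _<_; _∸_; z≤n; s≤s)
open import Data.Nat.Properties
  using (suc-injective; ≤-refl; ≤-trans; ≤-antisym; ≤-pred; m≤n⇒m≤1+n; <⇒≱; ≮⇒≥; ∸-monoˡ-≤; anyUpTo?; module ≤-Reasoning)
open import Data.Nat.Induction using (<-wellFounded)
open import Induction.WellFounded using (Acc; acc)
open import Data.Bool using (true; T)
open import Data.Unit using (tt)
open import Data.Fin using (_≟_)
open import Data.Fin.Properties using (any?)
open import Data.Fin.Subset using (⊤)
open import Data.Fin.Subset.Properties using (∣p∣≤n; ∣⊤∣≡n; ∣p∣≡n⇒p≡⊤)
open import Data.Vec using (lookup)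
open import Data.Vec.Properties using (lookup-replicate)
open import Data.List using (List; []; _∷_; length)
open import Data.List.Relation.Unary.All as All using (All; []; _∷_)
open import Data.List.Relation.Unary.AllPairs using ([]; _∷_)
open import Data.Product using (Σ; ∃; _,_)
import Data.Product as Product
open import Relation.Binary.PropositionalEquality using (_≡_; refl; sym; trans; cong; subst)
open import Relation.Nullary using (Dec; yes; no)
open import Relation.Nullary.Decidable using (map′; T?; _×-dec_)
open import Function.Base using (_⟨_⟩_)
open import Function.Bundles using (_⇔_; mk⇔)
open import Function.Properties.Equivalence using () renaming (trans to ⇔-trans)

module _ (G : Graph) where
  open Graph G using (n; adj)

  Minimal : ∀ {u v} → Walk G u v → Set
  Minimal {u} {v} p = ∀ (q : Walk G u v) → len G p ≤ len G q

  walkOfLength? : ∀ u v m → Dec (∃ λ (p : Walk G u v) → len G p ≡ m)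
  walkOfLength? u v zero with u ≟ v
  ... | yes refl = yes ([ u ] , refl)
  ... | no u≢v   = no λ { ([ _ ] , _) → u≢v refl ; (step _ _ _ , ()) }
  walkOfLength? u v (suc m) =
    map′ (λ { (_ , u~w , p , refl) → step u u~w p , refl })
         (λ { ([ _ ] , ()) ; (step _ {w} u~w p , eq) → w , u~w , p , suc-injective eq })
         (any? λ w → T? (adj u w) ×-dec walkOfLength? w v m)

  minimalWalk : ∀ {u v} (p : Walk G u v) → Acc _<_ (len G p) → Σ (Walk G u v) Minimal
  minimalWalk p (acc shorter) with anyUpTo? (walkOfLength? _ _) (len G p)
  ... | yes (_ , q<p , q , refl) = minimalWalk q (shorter q<p)
  ... | no ∄shorter = p , λ q → ≮⇒≥ λ q<p → ∄shorter (len G q , q<p , q , refl)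

  suffixWalks : ∀ {w v} (p : Walk G w v) →
                All (λ y → Σ (Walk G y v) λ q → len G q ≤ len G p) (vertices G p)
  suffixWalks [ v ]          = ([ v ] , ≤-refl) ∷ []
  suffixWalks (step u u~w p) =
    (step u u~w p , ≤-refl) ∷ All.map (Product.map₂ m≤n⇒m≤1+n) (suffixWalks p)

  -- A repetition of the first vertex u would leave a shorter suffix walk from u.
  minimal⇒isPath : ∀ {u v} {p : Walk G u v} → Minimal p → IsPath G p
  minimal⇒isPath {p = [ _ ]} _ = [] ∷ []
  minimal⇒isPath {p = step u u~w p} minimal =
    All.map (λ { (q , q≤p) refl → <⇒≱ (s≤s q≤p) (minimal q) }) (suffixWalks p)
    ∷ minimal⇒isPath (λ r → ≤-pred (minimal (step u u~w r)))

  shortestPath : ∀ {u v} → Walk G u v → Σ (Walk G u v) (IsShortestPath G)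
  shortestPath p with minimalWalk p (<-wellFounded _)
  ... | q , minimal = q , minimal⇒isPath minimal , minimal

  length-initVerts : ∀ {u v} (p : Walk G u v) → length (initVerts G p) ≡ len G p
  length-initVerts [ _ ]        = refl
  length-initVerts (step _ _ p) = cong suc (length-initVerts p)

  length-internal : ∀ {u v} (p : Walk G u v) → length (internal G p) ≡ len G p ∸ 1
  length-internal [ _ ]        = refl
  length-internal (step _ _ p) = length-initVerts p

  T-lookup-⊤ : ∀ u → T (lookup (⊤ {n}) u)
  T-lookup-⊤ u = subst T (sym (lookup-replicate u true)) tt

  countIn-⊤ : ∀ (xs : List (V G)) → countIn G ⊤ xs ≡ length xs
  countIn-⊤ []       = refl
  countIn-⊤ (x ∷ xs) rewrite lookup-replicate {n = n} x true = cong suc (countIn-⊤ xs)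

  countIn-⊤-internal : ∀ {u v} (p : Walk G u v) → countIn G ⊤ (internal G p) ≡ len G p ∸ 1
  countIn-⊤-internal p = trans (countIn-⊤ (internal G p)) (length-internal p)

  isMutualVisNumber-n⇔mutualVisible-⊤ : ∀ k → IsMutualVisNumber G k n ⇔ MutualVisible G k ⊤
  isMutualVisNumber-n⇔mutualVisible-⊤ k = mk⇔
    (λ { ((X , visible , ∣X∣≡n) , _) → subst (MutualVisible G k) (∣p∣≡n⇒p≡⊤ ∣X∣≡n) visible })
    (λ visible → (⊤ , visible , ∣⊤∣≡n n) , λ X _ → ∣p∣≤n X)

  Distances∸1≤ : ℕ → Set
  Distances∸1≤ k = ∀ u v m → Dist G u v m → m ∸ 1 ≤ k

  mutualVisible-⊤⇒distances∸1≤ : ∀ {k} → MutualVisible G k ⊤ → Distances∸1≤ k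
  mutualVisible-⊤⇒distances∸1≤ {k} visible u v _ (p , (_ , p-minimal) , refl) with u ≟ v
  ... | yes refl = ≤-trans (∸-monoˡ-≤ 1 (p-minimal [ u ])) z≤n
  ... | no u≢v with visible u v (T-lookup-⊤ u) (T-lookup-⊤ v) u≢v
  ...   | q , (_ , q-minimal) , count≤k = begin
    len G p ∸ 1                ≡⟨ cong (_∸ 1) (≤-antisym (p-minimal q) (q-minimal p)) ⟩
    len G q ∸ 1                ≡⟨ countIn-⊤-internal q ⟨
    countIn G ⊤ (internal G q) ≤⟨ count≤k ⟩
    k                          ∎
    where open ≤-Reasoning

  distances∸1≤⇒mutualVisible-⊤ : ∀ {k} → Connected G → Distances∸1≤ k → MutualVisible G k ⊤
  distances∸1≤⇒mutualVisible-⊤ {k} connected bounded u v _ _ _ with shortestPath (connected u v)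
  ... | q , q-shortest = q , q-shortest , (begin
    countIn G ⊤ (internal G q) ≡⟨ countIn-⊤-internal q ⟩
    len G q ∸ 1                ≤⟨ bounded u v (len G q) (q , q-shortest , refl) ⟩
    k                          ∎)
    where open ≤-Reasoning

  distances∸1≤⇔diameter∸1≤ : ∀ {d} k → HasDiameter G d → Distances∸1≤ k ⇔ d ∸ 1 ≤ k
  distances∸1≤⇔diameter∸1≤ {d} k (d-bound , u , v , uv-diametral) = mk⇔
    (λ bounded → bounded u v d uv-diametral)
    (λ d∸1≤k x y m xy-dist → ≤-trans (∸-monoˡ-≤ 1 (d-bound x y m xy-dist)) d∸1≤k)

theorem3p8 : (G : Graph) (d k : ℕ) → Connected G → HasDiameter G d →
    (IsMutualVisNumber G k (Graph.n G) ⇔ (d ∸ 1 ≤ k))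
theorem3p8 G d k connected diameter =
  isMutualVisNumber-n⇔mutualVisible-⊤ G k
    ⟨ ⇔-trans ⟩ mk⇔ (mutualVisible-⊤⇒distances∸1≤ G) (distances∸1≤⇒mutualVisible-⊤ G connected)
    ⟨ ⇔-trans ⟩ distances∸1≤⇔diameter∸1≤ G k diameter
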